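{- Let $\mathcal{F}$ be a $k$-dimensional $M$-part Sperner multi-family with parameters $\{L_P:P\in\binom{[M]}{k}\}$ on $X=X_1\uplus\cdots\uplus X_M$, with profile matrix $(p_{i_1,\ldots,i_M})_{(i_1,\ldots,i_M)\in\pi_M}$. Then for every $P\in\binom{[M]}{k}$, $$\sum_{(i_1,\ldots,i_M)\in\pi_M}\frac{p_{i_1,\ldots,i_M}}{\prod_{j=1}^M\binom{m_j}{i_j}}\le \frac{L_P}{\prod_{j\in P}n_j}\prod_{j=1}^M n_j.$$
   Context: $X$ is a finite set with a fixed partition $X=X_1\uplus\cdots\uplus X_M$, $|X_i|=m_i$, and $n_i=m_i+1$. For a positive integer $n$, $[n]=\{1,\ldots,n\}$, $[n]^{\star}=\{0,\ldots,n-1\}$, and $\pi_M=\prod_{i=1}^M[n_i]^{\star}$. A multi-family of subsets of $X$ is a multiset of subsets of $X$; $\#[F,\mathcal{F}]$ denotes the multiplicity of $F$ in $\mathcal{F}$ and all counts are with multiplicity. Fix $k\in[M]$ and positive integers $L_P$ for $P\in\binom{[M]}{k}$. $\mathcal{F}$ is a $k$-dimensional $M$-part Sperner multi-family with parameters $\{L_P\}$ if for every $P\in\binom{[M]}{k}$, every choice of chains $\mathcal{C}_j$ (families of subsets of $X_j$ totally ordered by inclusion) for $j\in P$, and every choice of sets $D_i\subseteq X_i$ for $i\in[M]\setminus P$, the number of members $F$ of $\mathcal{F}$ (counted with multiplicity) with $F\cap X_j\in\mathcal{C}_j$ for all $j\in P$ and $F\cap X_i=D_i$ for all $i\notin P$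 is at most $L_P$. The profile vector of $F\subseteq X$ is $(|F\cap X_1|,\ldots,|F\cap X_M|)\in\pi_M$, and the profile matrix of $\mathcal{F}$ has entries $p_{i_1,\ldots,i_M}$ = number of members of $\mathcal{F}$ (with multiplicity) with profile vector $(i_1,\ldots,i_M)$. -}

module Defs where

open import Data.Nat as ℕ using (ℕ; zero; suc; _≤_)
open import Data.Nat.Combinatorics using (_C_)
open import Data.Bool using (Bool; true; false; if_then_else_; _∧_)
open import Data.Fin as Fin using (Fin; toℕ)
open import Data.Fin.Subset using (Subset; _⊆_; ∣_∣)
open import Data.Vec using (lookup)
import Data.Vec.Properties as VecP
open import Data.Bool.Properties using () renaming (_≟_ to _≟ᴮ_)
open import Data.List using (List; []; _∷_; map; concatMap; foldr; filterᵇ; length; allFin)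
open import Data.Integer using (+_)
open import Data.Rational as ℚ using (ℚ; 0ℚ)
open import Data.Sum using (_⊎_)
open import Data.Product using (_×_)
open import Data.Bool.ListAction using (and)
open import Relation.Nullary.Decidable using (⌊_⌋)
open import Relation.Binary.PropositionalEquality using (_≡_)

-- The ground set X = X_1 ⊎ ... ⊎ X_M is described by M and the part sizes
-- m : Fin M → ℕ (part j is Fin (m j)).  A subset F of X is given by its
-- traces F ∩ X_j, i.e. a function (j : Fin M) → Subset (m j).
SubsetX : (M : ℕ) → (Fin M → ℕ) → Set
SubsetX M m = (j : Fin M) → Subset (m j)

-- A multi-family of subsets of X (a finite multiset, represented as a list;
-- all counts are with multiplicity).
MultiFamily : (M : ℕ) → (Fin M → ℕ) → Set
MultiFamily M m = List (SubsetX M m)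

count : ∀ {A : Set} → (A → Bool) → List A → ℕ
count t xs = length (filterᵇ t xs)

allᵇ : ∀ {A : Set} → (A → Bool) → List A → Bool
allᵇ p xs = and (map p xs)

eqSub : ∀ {n} → Subset n → Subset n → Bool
eqSub A B = ⌊ VecP.≡-dec _≟ᴮ_ A B ⌋

IsChain : ∀ {n} → (Subset n → Bool) → Set
IsChain {n} C = ∀ (A B : Subset n) → C A ≡ true → C B ≡ true → (A ⊆ B) ⊎ (B ⊆ A)

mem : ∀ {M} → Fin M → Subset M → Bool
mem j P = lookup P j

matches : ∀ {M} {m : Fin M → ℕ} → Subset M → ((j : Fin M) → Subset (m j) → Bool)
          → SubsetX M m → SubsetX M m → Bool
matches {M} P Ch D F =
  allᵇ (λ j → if mem j P then Ch j (F j) else eqSub (F j) (D j)) (allFin M)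

IsSperner : (M : ℕ) (m : Fin M → ℕ) (k : ℕ) (L : Subset M → ℕ) → MultiFamily M m → Set
IsSperner M m k L 𝓕 =
  ∀ (P : Subset M) → ∣ P ∣ ≡ k →
  ∀ (Ch : (j : Fin M) → Subset (m j) → Bool) →
  (∀ j → mem j P ≡ true → IsChain (Ch j)) →
  ∀ (D : SubsetX M m) →
  count (matches P Ch D) 𝓕 ≤ L P

-- Profile vectors: elements of π_M = ∏_j [n_j]^⋆ with n_j = m_j + 1.
Profile : (M : ℕ) → (Fin M → ℕ) → Set
Profile M m = (j : Fin M) → Fin (suc (m j))

profile : ∀ {M} {m : Fin M → ℕ} → SubsetX M m → Profile M m
profile F j = Fin.fromℕ< (ℕ.s≤s (Data.Fin.Subset.Properties.∣p∣≤n (F j)))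
  where import Data.Fin.Subset.Properties

eqProfile : ∀ {M} {m : Fin M → ℕ} → Profile M m → Profile M m → Bool
eqProfile {M} u v = allᵇ (λ j → toℕ (u j) ℕ.≡ᵇ toℕ (v j)) (allFin M)

allProfiles : (M : ℕ) (m : Fin M → ℕ) → List (Profile M m)
allProfiles zero m = (λ ()) ∷ []
allProfiles (suc M) m =
  concatMap (λ i → map (λ v → cons i v) (allProfiles M (λ j → m (Fin.suc j))))
            (allFin (suc (m Fin.zero)))
  where
  cons : Fin (suc (m Fin.zero)) → Profile M (λ j → m (Fin.suc j)) → Profile (suc M) m
  cons i v Fin.zero = i
  cons i v (Fin.suc j) = v j

profileMatrix : ∀ {M} {m : Fin M → ℕ} → MultiFamily M m → Profile M m → ℕ
profileMatrix 𝓕 v = count (λ F → eqProfile (profile F) v) 𝓕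

prodFin : (M : ℕ) → (Fin M → ℕ) → ℕ
prodFin M f = foldr ℕ._*_ 1 (map f (allFin M))

-- rational a / b; all denominators used below are nonzero
_÷_ : ℕ → ℕ → ℚ
a ÷ zero = 0ℚ
a ÷ suc b = (+ a) ℚ./ suc b

sumℚ : List ℚ → ℚ
sumℚ = foldr ℚ._+_ 0ℚ

ℕtoℚ : ℕ → ℚ
ℕtoℚ a = (+ a) ℚ./ 1

lhs : (M : ℕ) (m : Fin M → ℕ) → MultiFamily M m → ℚ
lhs M m 𝓕 = sumℚ (map (λ v → profileMatrix 𝓕 v ÷ prodFin M (λ j → m j C toℕ (v j)))
                      (allProfiles M m))

rhs : (M : ℕ) (m : Fin M → ℕ) → (Subset M → ℕ) → Subset M → ℚ
rhs M m L P = (L P ÷ prodFin M (λ j → if mem j P then suc (m j) else 1))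
              ℚ.* ℕtoℚ (prodFin M (λ j → suc (m j)))

module Submission where

-- Fix P with ∣ P ∣ = k.  Call a selector tuple a choice, for every part j, of
-- a maximal chain of subsets of X_j when j ∈ P (there are m_j! of them), and
-- of an entry of a list of (m_j+1)! subsets of X_j in which every A occurs
-- a!(m_j-a)! times, a = ∣ A ∣, when j ∉ P.  A set A ⊆ X_j lies on exactly
-- a!(m_j-a)! maximal chains as well, so every member F of the family is
-- selected by exactly w(F) = ∏_j ∣F_j∣! (m_j-∣F_j∣)! tuples, while by the
-- Sperner condition each tuple selects at most L_P members.  Double counting
-- gives Σ_F w(F) ≤ L_P ∏_{j ∈ P} m_j! ∏_{j ∉ P} (m_j+1)!.  Since
-- binom(m_j, i) · i!(m_j-i)! = m_j!, dividing by ∏_j m_j! and grouping the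
-- members by profile turns this into the stated inequality.

open import Defs
open import Data.Nat using (ℕ; _≤_)
open import Data.Fin using (Fin)
open import Data.Fin.Subset using (Subset; ∣_∣)
open import Data.Rational using () renaming (_≤_ to _≤ℚ_)
open import Relation.Binary.PropositionalEquality using (_≡_)

open import Algebra.Properties.CommutativeSemigroup using (interchange)
open import Data.Bool using (Bool; true; false; _∧_; not; if_then_else_)
open import Data.Bool.ListAction using (and)
open import Data.Bool.Properties using (∧-zeroʳ; ∧-identityʳ) renaming (_≟_ to _≟ᴮ_)
open import Data.Empty using (⊥-elim)
open import Data.Fin using (toℕ)
open import Data.Fin.Properties using (toℕ<n; toℕ-fromℕ<)
import Data.Fin.Subset as Subset
open import Data.Fin.Subset using (_⊆_)
open import Data.Fin.Subset.Properties using (∣p∣≤n; out⊆; in⊆in; s⊆s)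
import Data.Integer as ℤ
open import Data.Integer.Properties using (pos-*; pos-+)
open import Data.List using (List; []; _∷_; _++_; map; concatMap; tabulate; foldr; allFin; length; downFrom)
open import Data.List.Properties using (length-++; length-map; length-downFrom; map-tabulate)
open import Data.List.Relation.Unary.All as All using (All; []; _∷_)
import Data.List.Relation.Unary.All.Properties as AllP
open import Data.Nat using (zero; suc; _+_; _*_; _∸_; _<_; _!; _≡ᵇ_; _≤?_; NonZero; ≢-nonZero⁻¹; z≤n; s≤s)
open import Data.Nat.Combinatorics using (_C_)
open import Data.Nat.Combinatorics.Specification using (nCk≡n!/k![n-k]!; [n∸k]!k!∣n!)
open import Data.Nat.Divisibility using (_∣_)
open import Data.Nat.DivMod using (m/n*n≡m)
open import Data.Nat.Properties
open import Data.Product using (Σ; _×_; _,_; proj₁; proj₂)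
open import Data.Rational using (ℚ; toℚᵘ)
open import Data.Rational.Properties using (toℚᵘ-fromℚᵘ; toℚᵘ-homo-+; toℚᵘ-homo-*; toℚᵘ-cancel-≤)
import Data.Rational.Unnormalised as ℚᵘ
open import Data.Rational.Unnormalised using (ℚᵘ; mkℚᵘ; *≡*; *≤*) renaming (_≃_ to _≃ᵘ_; _≤_ to _≤ᵘ_)
open import Data.Rational.Unnormalised.Properties using ()
  renaming (module ≤-Reasoning to ℚᵘ-≤-Reasoning; ≃-trans to ≃ᵘ-trans; +-cong to +ᵘ-cong; *-cong to *ᵘ-cong)
open import Data.Sum using (inj₁; inj₂)
open import Data.Vec using ([]; _∷_)
import Data.Vec.Properties as VecP
open import Function using (_∘_; id)
open import Relation.Binary.PropositionalEquality using (refl; sym; trans; cong; cong₂; subst; subst₂; module ≡-Reasoning)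
open import Relation.Nullary using (does; yes; no)
open import Relation.Nullary.Decidable using (⌊_⌋)

𝟙 : Bool → ℕ
𝟙 true = 1
𝟙 false = 0

𝟙-∧ : ∀ a b → 𝟙 (a ∧ b) ≡ 𝟙 a * 𝟙 b
𝟙-∧ false b = refl
𝟙-∧ true b = sym (+-identityʳ (𝟙 b))

sumL : ∀ {A : Set} → (A → ℕ) → List A → ℕ
sumL f [] = 0
sumL f (x ∷ xs) = f x + sumL f xs

module _ {A : Set} where

  sumL-cong : ∀ {f g : A → ℕ} xs → (∀ x → f x ≡ g x) → sumL f xs ≡ sumL g xs
  sumL-cong [] e = refl
  sumL-cong (x ∷ xs) e = cong₂ _+_ (e x) (sumL-cong xs e)

  sumL-++ : ∀ (f : A → ℕ) xs ys → sumL f (xs ++ ys) ≡ sumL f xs + sumL f ys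
  sumL-++ f [] ys = refl
  sumL-++ f (x ∷ xs) ys = trans (cong (f x +_) (sumL-++ f xs ys)) (sym (+-assoc (f x) _ _))

  sumL-zero : ∀ (xs : List A) → sumL (λ _ → 0) xs ≡ 0
  sumL-zero [] = refl
  sumL-zero (x ∷ xs) = sumL-zero xs

  sumL-+ : ∀ (f g : A → ℕ) xs → sumL (λ x → f x + g x) xs ≡ sumL f xs + sumL g xs
  sumL-+ f g [] = refl
  sumL-+ f g (x ∷ xs) = trans (cong (f x + g x +_) (sumL-+ f g xs))
                              (interchange +-commutativeSemigroup (f x) (g x) _ _)

  sumL-*ˡ : ∀ c (f : A → ℕ) xs → c * sumL f xs ≡ sumL (λ x → c * f x) xs
  sumL-*ˡ c f [] = *-zeroʳ c
  sumL-*ˡ c f (x ∷ xs) = trans (*-distribˡ-+ c (f x) _) (cong (c * f x +_) (sumL-*ˡ c f xs))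

  sumL-*ʳ : ∀ c (f : A → ℕ) xs → sumL f xs * c ≡ sumL (λ x → f x * c) xs
  sumL-*ʳ c f xs = trans (*-comm _ c) (trans (sumL-*ˡ c f xs) (sumL-cong xs (λ x → *-comm c (f x))))

  sumL-const : ∀ c (xs : List A) → sumL (λ _ → c) xs ≡ c * length xs
  sumL-const c [] = sym (*-zeroʳ c)
  sumL-const c (x ∷ xs) = trans (cong (c +_) (sumL-const c xs)) (sym (*-suc c (length xs)))

  sumL-mono : ∀ {f g : A → ℕ} xs → All (λ x → f x ≤ g x) xs → sumL f xs ≤ sumL g xs
  sumL-mono [] [] = z≤n
  sumL-mono (x ∷ xs) (p ∷ ps) = +-mono-≤ p (sumL-mono xs ps)

  count≡sumL : ∀ (t : A → Bool) xs → count t xs ≡ sumL (λ x → 𝟙 (t x)) xs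
  count≡sumL t [] = refl
  count≡sumL t (x ∷ xs) with t x
  ... | true = cong suc (count≡sumL t xs)
  ... | false = count≡sumL t xs

module _ {A B : Set} where

  sumL-map : ∀ (f : B → ℕ) (g : A → B) xs → sumL f (map g xs) ≡ sumL (f ∘ g) xs
  sumL-map f g [] = refl
  sumL-map f g (x ∷ xs) = cong (f (g x) +_) (sumL-map f g xs)

  sumL-concatMap : ∀ (f : B → ℕ) (g : A → List B) xs →
    sumL f (concatMap g xs) ≡ sumL (λ x → sumL f (g x)) xs
  sumL-concatMap f g [] = refl
  sumL-concatMap f g (x ∷ xs) =
    trans (sumL-++ f (g x) (concatMap g xs)) (cong (sumL f (g x) +_) (sumL-concatMap f g xs))

  sumL-swap : ∀ (f : A → B → ℕ) xs ys →
    sumL (λ x → sumL (f x) ys) xs ≡ sumL (λ y → sumL (λ x → f x y) xs) ys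
  sumL-swap f [] ys = sym (sumL-zero ys)
  sumL-swap f (x ∷ xs) ys = trans (cong (sumL (f x) ys +_) (sumL-swap f xs ys))
                                  (sym (sumL-+ (f x) (λ y → sumL (λ x → f x y) xs) ys))

  length-concatMap-const : ∀ c (g : A → List B) xs → (∀ x → length (g x) ≡ c) →
    length (concatMap g xs) ≡ c * length xs
  length-concatMap-const c g [] e = sym (*-zeroʳ c)
  length-concatMap-const c g (x ∷ xs) e = begin
      length (g x ++ concatMap g xs)          ≡⟨ length-++ (g x) ⟩
      length (g x) + length (concatMap g xs)  ≡⟨ cong₂ _+_ (e x) (length-concatMap-const c g xs e) ⟩
      c + c * length xs                       ≡⟨ *-suc c (length xs) ⟨
      c * suc (length xs)                     ∎
    where open ≡-Reasoning

Π : (M : ℕ) → (Fin M → ℕ) → ℕ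
Π zero f = 1
Π (suc M) f = f Fin.zero * Π M (f ∘ Fin.suc)

Π-cong : ∀ M {f g : Fin M → ℕ} → (∀ j → f j ≡ g j) → Π M f ≡ Π M g
Π-cong zero e = refl
Π-cong (suc M) e = cong₂ _*_ (e Fin.zero) (Π-cong M (e ∘ Fin.suc))

Π-* : ∀ M (f g : Fin M → ℕ) → Π M (λ j → f j * g j) ≡ Π M f * Π M g
Π-* zero f g = refl
Π-* (suc M) f g = trans (cong (f Fin.zero * g Fin.zero *_) (Π-* M (f ∘ Fin.suc) (g ∘ Fin.suc)))
                        (interchange *-commutativeSemigroup (f Fin.zero) (g Fin.zero) _ _)

Π-nonZero : ∀ M (f : Fin M → ℕ) → (∀ j → NonZero (f j)) → NonZero (Π M f)
Π-nonZero zero f nz = _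
Π-nonZero (suc M) f nz = m*n≢0 _ _ {{nz Fin.zero}} {{Π-nonZero M (f ∘ Fin.suc) (nz ∘ Fin.suc)}}

prodFin≡Π : ∀ M f → prodFin M f ≡ Π M f
prodFin≡Π M f = product-tabulate M id
  where
  product-tabulate : ∀ {X : Set} M (g : Fin M → X) {h : X → ℕ} → foldr _*_ 1 (map h (tabulate g)) ≡ Π M (h ∘ g)
  product-tabulate zero g = refl
  product-tabulate (suc M) g {h} = cong (h (g Fin.zero) *_) (product-tabulate M (g ∘ Fin.suc))

𝟙-allᵇ : ∀ M (p : Fin M → Bool) → 𝟙 (allᵇ p (allFin M)) ≡ Π M (𝟙 ∘ p)
𝟙-allᵇ M p = and-tabulate M id
  where
  and-tabulate : ∀ {X : Set} M (g : Fin M → X) {q : X → Bool} →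
    𝟙 (and (map q (tabulate g))) ≡ Π M (𝟙 ∘ q ∘ g)
  and-tabulate zero g = refl
  and-tabulate (suc M) g {q} =
    trans (𝟙-∧ (q (g Fin.zero)) _) (cong (𝟙 (q (g Fin.zero)) *_) (and-tabulate M (g ∘ Fin.suc)))

-- Counting the levels t ∈ {0, …, k-1} (the list downFrom k) on either side
-- of a threshold; these counts are the recursions for the number of chains.

levels-atLeast : ∀ b k → sumL (λ t → 𝟙 ⌊ b ≤? t ⌋) (downFrom k) ≡ k ∸ b
levels-atLeast b zero = sym (0∸n≡0 b)
levels-atLeast b (suc k) with b ≤? k
... | yes b≤k = trans (cong suc (levels-atLeast b k)) (sym (+-∸-assoc 1 b≤k))
... | no b≰k = trans (levels-atLeast b k) (trans (m≤n⇒m∸n≡0 (<⇒≤ k<b)) (sym (m≤n⇒m∸n≡0 k<b)))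
  where k<b = ≰⇒> b≰k

levels-all-atMost : ∀ a k → k ≤ suc a → sumL (λ t → 𝟙 ⌊ t ≤? a ⌋) (downFrom k) ≡ k
levels-all-atMost a zero _ = refl
levels-all-atMost a (suc k) k<sa with k ≤? a
... | yes _ = cong suc (levels-all-atMost a k (<⇒≤ k<sa))
... | no k≰a = ⊥-elim (k≰a (≤-pred k<sa))

levels-atMost : ∀ a k → a < k → sumL (λ t → 𝟙 ⌊ t ≤? a ⌋) (downFrom k) ≡ suc a
levels-atMost a (suc k) a<sk with k ≤? a
... | yes k≤a = cong suc (trans (levels-all-atMost a k (m≤n⇒m≤1+n k≤a)) (≤-antisym k≤a (≤-pred a<sk)))
... | no k≰a = levels-atMost a k (≰⇒> k≰a)

levels-above : ∀ a k → sumL (λ t → 𝟙 (not ⌊ t ≤? a ⌋)) (downFrom k) ≡ k ∸ suc a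
levels-above a k = trans (sumL-cong (downFrom k) complement) (levels-atLeast (suc a) k)
  where
  complement : ∀ t → 𝟙 (not ⌊ t ≤? a ⌋) ≡ 𝟙 ⌊ suc a ≤? t ⌋
  complement t with t ≤? a | suc a ≤? t
  ... | yes t≤a | yes a<t = ⊥-elim (<⇒≱ a<t t≤a)
  ... | yes _ | no _ = refl
  ... | no _ | yes _ = refl
  ... | no t≰a | no a≮t = ⊥-elim (a≮t (≰⇒> t≰a))

-- weight n a = a! (n-a)!: the number of maximal chains of subsets of an
-- n-set passing through a fixed a-set; it satisfies C(n,a) · weight n a = n!.
weight : ℕ → ℕ → ℕ
weight n a = a ! * (n ∸ a) !

-- adding a new element outside / inside the fixed set
weight-out : ∀ n a → a ≤ n → weight n a * suc (n ∸ a) ≡ weight (suc n) a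
weight-out n a a≤n = begin
  a ! * (n ∸ a) ! * suc (n ∸ a)    ≡⟨ *-assoc (a !) _ _ ⟩
  a ! * ((n ∸ a) ! * suc (n ∸ a))  ≡⟨ cong (a ! *_) (*-comm ((n ∸ a) !) (suc (n ∸ a))) ⟩
  a ! * (suc (n ∸ a) !)            ≡⟨ cong (λ d → a ! * d !) (+-∸-assoc 1 a≤n) ⟨
  a ! * (suc n ∸ a) !              ∎
  where open ≡-Reasoning

weight-in : ∀ n a → weight n a * suc a ≡ weight (suc n) (suc a)
weight-in n a = begin
  a ! * (n ∸ a) ! * suc a    ≡⟨ *-comm (a ! * (n ∸ a) !) (suc a) ⟩
  suc a * (a ! * (n ∸ a) !)  ≡⟨ *-assoc (suc a) (a !) _ ⟨
  suc a ! * (n ∸ a) !        ∎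
  where open ≡-Reasoning

binomial-weight : ∀ n a → a ≤ n → (n C a) * weight n a ≡ n !
binomial-weight n a a≤n =
  trans (cong (_* weight n a) (nCk≡n!/k![n-k]! a≤n)) (m/n*n≡m {{a !* (n ∸ a) !≢0}} weight∣n!)
  where
  weight∣n! : weight n a ∣ n !
  weight∣n! = subst (_∣ n !) (*-comm ((n ∸ a) !) (a !)) ([n∸k]!k!∣n! a≤n)

-- A
-- maximal chain of Fin (suc n) arises from one of Fin n by choosing the level
-- t ≤ n at which the new element 0 enters: it contains false ∷ A for the
-- members A of size ≤ t and true ∷ A for the members A of size ≥ t.
extendChain : ∀ {n} → ℕ → (Subset n → Bool) → Subset (suc n) → Bool
extendChain t c (false ∷ A) = c A ∧ ⌊ ∣ A ∣ ≤? t ⌋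
extendChain t c (true ∷ A) = c A ∧ ⌊ t ≤? ∣ A ∣ ⌋

maximalChains : (n : ℕ) → List (Subset n → Bool)
maximalChains zero = (λ _ → true) ∷ []
maximalChains (suc n) = concatMap (λ t → map (extendChain t) (maximalChains n)) (downFrom (suc n))

length-maximalChains : ∀ n → length (maximalChains n) ≡ n !
length-maximalChains zero = refl
length-maximalChains (suc n) = begin
  length (maximalChains (suc n))   ≡⟨ length-concatMap-const (n !) block (downFrom (suc n)) blocks ⟩
  n ! * length (downFrom (suc n))  ≡⟨ cong (n ! *_) (length-downFrom (suc n)) ⟩
  n ! * suc n                      ≡⟨ *-comm (n !) (suc n) ⟩
  suc n !                          ∎
  where
  open ≡-Reasoning
  block : ℕ → List (Subset (suc n) → Bool)
  block t = map (extendChain t) (maximalChains n)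
  blocks : ∀ t → length (block t) ≡ n !
  blocks t = trans (length-map (extendChain t) (maximalChains n)) (length-maximalChains n)

chains-through : ∀ n (A : Subset n) → sumL (λ c → 𝟙 (c A)) (maximalChains n) ≡ weight n ∣ A ∣
chains-through zero [] = refl
chains-through (suc n) (x ∷ A) = begin
  sumL (λ c → 𝟙 (c (x ∷ A))) (maximalChains (suc n))
    ≡⟨ sumL-concatMap _ (λ t → map (extendChain t) (maximalChains n)) (downFrom (suc n)) ⟩
  sumL (λ t → sumL (λ c → 𝟙 (c (x ∷ A))) (map (extendChain t) (maximalChains n))) (downFrom (suc n))
    ≡⟨ sumL-cong (downFrom (suc n)) (λ t → trans (sumL-map (λ c → 𝟙 (c (x ∷ A))) (extendChain t) (maximalChains n)) (split t)) ⟩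
  sumL (λ t → weight n a * 𝟙 (level x t)) (downFrom (suc n))
    ≡⟨ sumL-*ˡ (weight n a) _ (downFrom (suc n)) ⟨
  weight n a * sumL (𝟙 ∘ level x) (downFrom (suc n))
    ≡⟨ count-levels x ⟩
  weight (suc n) ∣ x ∷ A ∣ ∎
  where
  open ≡-Reasoning
  a = ∣ A ∣
  -- the condition on the entry level t for x ∷ A to lie on extendChain t c
  level : Bool → ℕ → Bool
  level false t = ⌊ a ≤? t ⌋
  level true t = ⌊ t ≤? a ⌋
  split : ∀ t → sumL (λ c → 𝟙 (extendChain t c (x ∷ A))) (maximalChains n) ≡ weight n a * 𝟙 (level x t)
  split t = begin
    sumL (λ c → 𝟙 (extendChain t c (x ∷ A))) (maximalChains n)
      ≡⟨ sumL-cong (maximalChains n) (factor x) ⟩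
    sumL (λ c → 𝟙 (c A) * 𝟙 (level x t)) (maximalChains n)
      ≡⟨ sumL-*ʳ _ (λ c → 𝟙 (c A)) (maximalChains n) ⟨
    sumL (λ c → 𝟙 (c A)) (maximalChains n) * 𝟙 (level x t)
      ≡⟨ cong (_* 𝟙 (level x t)) (chains-through n A) ⟩
    weight n a * 𝟙 (level x t) ∎
    where
    factor : ∀ x c → 𝟙 (extendChain t c (x ∷ A)) ≡ 𝟙 (c A) * 𝟙 (level x t)
    factor false c = 𝟙-∧ (c A) _
    factor true c = 𝟙-∧ (c A) _
  count-levels : ∀ x → weight n a * sumL (𝟙 ∘ level x) (downFrom (suc n)) ≡ weight (suc n) ∣ x ∷ A ∣
  count-levels false = trans (cong (weight n a *_) (trans (levels-atLeast a (suc n)) (+-∸-assoc 1 (∣p∣≤n A))))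
                             (weight-out n a (∣p∣≤n A))
  count-levels true = trans (cong (weight n a *_) (levels-atMost a (suc n) (s≤s (∣p∣≤n A))))
                            (weight-in n a)

∧-trueˡ : ∀ {a b} → a ∧ b ≡ true → a ≡ true
∧-trueˡ {true} _ = refl

≤-level : ∀ {a} {m n : ℕ} → a ∧ ⌊ m ≤? n ⌋ ≡ true → m ≤ n
≤-level {true} {m} {n} e with m ≤? n
... | yes m≤n = m≤n

SizeOrdered : ∀ {n} → (Subset n → Bool) → Set
SizeOrdered {n} c = ∀ (A B : Subset n) → c A ≡ true → c B ≡ true → ∣ A ∣ ≤ ∣ B ∣ → A ⊆ B

sizeOrdered⇒chain : ∀ {n} (c : Subset n → Bool) → SizeOrdered c → IsChain c
sizeOrdered⇒chain c ord A B A∈c B∈c with ≤-total ∣ A ∣ ∣ B ∣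
... | inj₁ ∣A∣≤∣B∣ = inj₁ (ord A B A∈c B∈c ∣A∣≤∣B∣)
... | inj₂ ∣B∣≤∣A∣ = inj₂ (ord B A B∈c A∈c ∣B∣≤∣A∣)

extendChain-sizeOrdered : ∀ {n} t (c : Subset n → Bool) → SizeOrdered c → SizeOrdered (extendChain t c)
extendChain-sizeOrdered t c ord (false ∷ A) (false ∷ B) A∈ B∈ le =
  s⊆s (ord A B (∧-trueˡ A∈) (∧-trueˡ B∈) le)
extendChain-sizeOrdered t c ord (true ∷ A) (true ∷ B) A∈ B∈ le =
  in⊆in (ord A B (∧-trueˡ A∈) (∧-trueˡ B∈) (≤-pred le))
extendChain-sizeOrdered t c ord (false ∷ A) (true ∷ B) A∈ B∈ le =
  out⊆ (ord A B (∧-trueˡ A∈) (∧-trueˡ B∈) (≤-trans (≤-level A∈) (≤-level B∈)))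
extendChain-sizeOrdered t c ord (true ∷ A) (false ∷ B) A∈ B∈ le =
  ⊥-elim (<⇒≱ (≤-trans le (≤-level B∈)) (≤-level A∈))

maximalChains-sizeOrdered : ∀ n → All SizeOrdered (maximalChains n)
maximalChains-sizeOrdered zero = (λ { [] [] _ _ _ x∈A → x∈A }) ∷ []
maximalChains-sizeOrdered (suc n) = AllP.concat⁺ (AllP.map⁺ (All.universal extended (downFrom (suc n))))
  where
  extended : ∀ t → All SizeOrdered (map (extendChain t) (maximalChains n))
  extended t = AllP.map⁺ (All.map (extendChain-sizeOrdered t _) (maximalChains-sizeOrdered n))

-- A list of subsets of Fin n in which every A occurs exactly weight n ∣ A ∣
-- times (as often as A lies on a maximal chain), hence of length
-- Σ_a C(n,a) a! (n-a)! = (n+1)!.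
weightedSubsets : (n : ℕ) → List (Subset n)
weightedSubsets zero = [] ∷ []
weightedSubsets (suc n) =
  concatMap (λ t → map (λ D → ⌊ t ≤? ∣ D ∣ ⌋ ∷ D) (weightedSubsets n)) (downFrom (suc (suc n)))

length-weightedSubsets : ∀ n → length (weightedSubsets n) ≡ suc n !
length-weightedSubsets zero = refl
length-weightedSubsets (suc n) = begin
  length (weightedSubsets (suc n))           ≡⟨ length-concatMap-const (suc n !) block (downFrom (suc (suc n))) blocks ⟩
  suc n ! * length (downFrom (suc (suc n)))  ≡⟨ cong (suc n ! *_) (length-downFrom (suc (suc n))) ⟩
  suc n ! * suc (suc n)                      ≡⟨ *-comm (suc n !) (suc (suc n)) ⟩
  suc (suc n) !                              ∎
  where
  open ≡-Reasoning
  block : ℕ → List (Subset (suc n))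
  block t = map (λ D → ⌊ t ≤? ∣ D ∣ ⌋ ∷ D) (weightedSubsets n)
  blocks : ∀ t → length (block t) ≡ suc n !
  blocks t = trans (length-map _ (weightedSubsets n)) (length-weightedSubsets n)

eqSub-sound : ∀ {n} {A B : Subset n} → eqSub A B ≡ true → A ≡ B
eqSub-sound {A = A} {B} e with VecP.≡-dec _≟ᴮ_ A B
... | yes A≡B = A≡B

eqSub-∷ : ∀ {n} x y (A B : Subset n) → eqSub (x ∷ A) (y ∷ B) ≡ does (x ≟ᴮ y) ∧ eqSub A B
eqSub-∷ x y A B with x ≟ᴮ y | VecP.≡-dec _≟ᴮ_ A B
... | yes _ | yes _ = refl
... | yes _ | no _ = refl
... | no _ | _ = refl

𝟙-eqSub-∷ : ∀ {n} x (b : Subset n → Bool) (A D : Subset n) →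
  𝟙 (eqSub (x ∷ A) (b D ∷ D)) ≡ 𝟙 (eqSub A D) * 𝟙 (does (x ≟ᴮ b A))
𝟙-eqSub-∷ x b A D rewrite eqSub-∷ x (b D) A D with eqSub A D in A≟D
... | false = cong 𝟙 (∧-zeroʳ (does (x ≟ᴮ b D)))
... | true with eqSub-sound A≟D
... | refl = trans (cong 𝟙 (∧-identityʳ (does (x ≟ᴮ b A)))) (sym (+-identityʳ _))

≟-true : ∀ b → does (true ≟ᴮ b) ≡ b
≟-true false = refl
≟-true true = refl

≟-false : ∀ b → does (false ≟ᴮ b) ≡ not b
≟-false false = refl
≟-false true = refl

copies : ∀ n (A : Subset n) → sumL (λ D → 𝟙 (eqSub A D)) (weightedSubsets n) ≡ weight n ∣ A ∣
copies zero [] = refl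
copies (suc n) (x ∷ A) = begin
  sumL (λ D → 𝟙 (eqSub (x ∷ A) D)) (weightedSubsets (suc n))
    ≡⟨ sumL-concatMap _ block levels ⟩
  sumL (λ t → sumL (λ D → 𝟙 (eqSub (x ∷ A) D)) (block t)) levels
    ≡⟨ sumL-cong levels (λ t → trans (sumL-map (λ D → 𝟙 (eqSub (x ∷ A) D)) _ (weightedSubsets n)) (split t)) ⟩
  sumL (λ t → weight n a * 𝟙 (level x t)) levels
    ≡⟨ sumL-*ˡ (weight n a) _ levels ⟨
  weight n a * sumL (𝟙 ∘ level x) levels
    ≡⟨ count-levels x ⟩
  weight (suc n) ∣ x ∷ A ∣ ∎
  where
  open ≡-Reasoning
  a = ∣ A ∣
  levels = downFrom (suc (suc n))
  block : ℕ → List (Subset (suc n))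
  block t = map (λ D → ⌊ t ≤? ∣ D ∣ ⌋ ∷ D) (weightedSubsets n)
  -- the condition on the level t for x ∷ A to be produced from A
  level : Bool → ℕ → Bool
  level x t = does (x ≟ᴮ ⌊ t ≤? a ⌋)
  split : ∀ t → sumL (λ D → 𝟙 (eqSub (x ∷ A) (⌊ t ≤? ∣ D ∣ ⌋ ∷ D))) (weightedSubsets n) ≡ weight n a * 𝟙 (level x t)
  split t = begin
    sumL (λ D → 𝟙 (eqSub (x ∷ A) (⌊ t ≤? ∣ D ∣ ⌋ ∷ D))) (weightedSubsets n)
      ≡⟨ sumL-cong (weightedSubsets n) (𝟙-eqSub-∷ x (λ D → ⌊ t ≤? ∣ D ∣ ⌋) A) ⟩
    sumL (λ D → 𝟙 (eqSub A D) * 𝟙 (level x t)) (weightedSubsets n)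
      ≡⟨ sumL-*ʳ _ (λ D → 𝟙 (eqSub A D)) (weightedSubsets n) ⟨
    sumL (λ D → 𝟙 (eqSub A D)) (weightedSubsets n) * 𝟙 (level x t)
      ≡⟨ cong (_* 𝟙 (level x t)) (copies n A) ⟩
    weight n a * 𝟙 (level x t) ∎
  count-levels : ∀ x → weight n a * sumL (𝟙 ∘ level x) levels ≡ weight (suc n) ∣ x ∷ A ∣
  count-levels false = trans (cong (weight n a *_) (begin
    sumL (𝟙 ∘ level false) levels            ≡⟨ sumL-cong levels (λ t → cong 𝟙 (≟-false ⌊ t ≤? a ⌋)) ⟩
    sumL (λ t → 𝟙 (not ⌊ t ≤? a ⌋)) levels  ≡⟨ levels-above a (suc (suc n)) ⟩
    suc n ∸ a                                ≡⟨ +-∸-assoc 1 (∣p∣≤n A) ⟩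
    suc (n ∸ a)                              ∎))
    (weight-out n a (∣p∣≤n A))
  count-levels true = trans (cong (weight n a *_) (begin
    sumL (𝟙 ∘ level true) levels             ≡⟨ sumL-cong levels (λ t → cong 𝟙 (≟-true ⌊ t ≤? a ⌋)) ⟩
    sumL (λ t → 𝟙 ⌊ t ≤? a ⌋) levels        ≡⟨ levels-atMost a (suc (suc n)) (s≤s (m≤n⇒m≤1+n (∣p∣≤n A))) ⟩
    suc a                                    ∎))
    (weight-in n a)

consT : ∀ {M} {T : Fin (suc M) → Set} → T Fin.zero → ((j : Fin M) → T (Fin.suc j)) → (j : Fin (suc M)) → T j
consT x v Fin.zero = x
consT x v (Fin.suc j) = v j

tuples : ∀ M {T : Fin M → Set} → ((j : Fin M) → List (T j)) → List ((j : Fin M) → T j)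
tuples zero ls = (λ ()) ∷ []
tuples (suc M) {T} ls = concatMap (λ x → map (consT {T = T} x) (tuples M (ls ∘ Fin.suc))) (ls Fin.zero)

sumL-tuples : ∀ M {T : Fin M → Set} (ls : (j : Fin M) → List (T j)) (g : (j : Fin M) → T j → ℕ) →
  sumL (λ c → Π M (λ j → g j (c j))) (tuples M ls) ≡ Π M (λ j → sumL (g j) (ls j))
sumL-tuples zero ls g = refl
sumL-tuples (suc M) {T} ls g = begin
  sumL G (concatMap (λ x → map (consT {T = T} x) rest) (ls Fin.zero))
    ≡⟨ sumL-concatMap G (λ x → map (consT {T = T} x) rest) (ls Fin.zero) ⟩
  sumL (λ x → sumL G (map (consT {T = T} x) rest)) (ls Fin.zero)
    ≡⟨ sumL-cong (ls Fin.zero) head ⟩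
  sumL (λ x → g Fin.zero x * Π M (λ j → sumL (g (Fin.suc j)) (ls (Fin.suc j)))) (ls Fin.zero)
    ≡⟨ sumL-*ʳ _ (g Fin.zero) (ls Fin.zero) ⟨
  sumL (g Fin.zero) (ls Fin.zero) * Π M (λ j → sumL (g (Fin.suc j)) (ls (Fin.suc j))) ∎
  where
  open ≡-Reasoning
  rest = tuples M (ls ∘ Fin.suc)
  G = λ (c : (j : Fin (suc M)) → T j) → Π (suc M) (λ j → g j (c j))
  head : ∀ x → sumL G (map (consT {T = T} x) rest) ≡ g Fin.zero x * Π M (λ j → sumL (g (Fin.suc j)) (ls (Fin.suc j)))
  head x = begin
    sumL G (map (consT {T = T} x) rest)
      ≡⟨ sumL-map G (consT {T = T} x) rest ⟩
    sumL (λ c → g Fin.zero x * Π M (λ j → g (Fin.suc j) (c j))) rest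
      ≡⟨ sumL-*ˡ (g Fin.zero x) _ rest ⟨
    g Fin.zero x * sumL (λ c → Π M (λ j → g (Fin.suc j) (c j))) rest
      ≡⟨ cong (g Fin.zero x *_) (sumL-tuples M (ls ∘ Fin.suc) (g ∘ Fin.suc)) ⟩
    g Fin.zero x * Π M (λ j → sumL (g (Fin.suc j)) (ls (Fin.suc j))) ∎

length-tuples : ∀ M {T : Fin M → Set} (ls : (j : Fin M) → List (T j)) →
  length (tuples M ls) ≡ Π M (length ∘ ls)
length-tuples zero ls = refl
length-tuples (suc M) {T} ls = begin
  length (tuples (suc M) ls)                          ≡⟨ length-concatMap-const (length rest) _ (ls Fin.zero) block ⟩
  length rest * length (ls Fin.zero)                  ≡⟨ cong (_* length (ls Fin.zero)) (length-tuples M (ls ∘ Fin.suc)) ⟩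
  Π M (length ∘ ls ∘ Fin.suc) * length (ls Fin.zero)  ≡⟨ *-comm _ (length (ls Fin.zero)) ⟩
  Π (suc M) (length ∘ ls)                             ∎
  where
  open ≡-Reasoning
  rest = tuples M (ls ∘ Fin.suc)
  block : ∀ x → length (map (consT {T = T} x) rest) ≡ length rest
  block x = length-map (consT {T = T} x) rest

tuples-all : ∀ M {T : Fin M → Set} (ls : (j : Fin M) → List (T j)) (Q : (j : Fin M) → T j → Set) →
  (∀ j → All (Q j) (ls j)) → All (λ c → ∀ j → Q j (c j)) (tuples M ls)
tuples-all zero ls Q h = (λ ()) ∷ []
tuples-all (suc M) {T} ls Q h =
  AllP.concat⁺ (AllP.map⁺ (All.map extend (h Fin.zero)))
  where
  extend : ∀ {x} → Q Fin.zero x → All (λ c → ∀ j → Q j (c j)) (map (consT {T = T} x) (tuples M (ls ∘ Fin.suc)))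
  extend qx = AllP.map⁺ (All.map (λ qv → λ { Fin.zero → qx ; (Fin.suc j) → qv j })
                                 (tuples-all M (ls ∘ Fin.suc) (Q ∘ Fin.suc) (h ∘ Fin.suc)))

double-count : ∀ {A B : Set} (sel : B → A → Bool) (w : A → ℕ) (𝓕 : List A) (bs : List B) (L : ℕ) →
  (∀ F → sumL (λ b → 𝟙 (sel b F)) bs ≡ w F) → All (λ b → count (sel b) 𝓕 ≤ L) bs →
  sumL w 𝓕 ≤ L * length bs
double-count sel w 𝓕 bs L selected bounded = begin
  sumL w 𝓕                                    ≡⟨ sumL-cong 𝓕 selected ⟨
  sumL (λ F → sumL (λ b → 𝟙 (sel b F)) bs) 𝓕  ≡⟨ sumL-swap (λ F b → 𝟙 (sel b F)) 𝓕 bs ⟩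
  sumL (λ b → sumL (λ F → 𝟙 (sel b F)) 𝓕) bs  ≡⟨ sumL-cong bs (λ b → count≡sumL (sel b) 𝓕) ⟨
  sumL (λ b → count (sel b) 𝓕) bs             ≤⟨ sumL-mono bs bounded ⟩
  sumL (λ _ → L) bs                           ≡⟨ sumL-const L bs ⟩
  L * length bs                               ∎
  where open ≤-Reasoning

-- The weight of a member F: the number of selector tuples that select it.
memberWeight : ∀ M (m : Fin M → ℕ) → SubsetX M m → ℕ
memberWeight M m F = Π M (λ j → weight (m j) ∣ F j ∣)

-- Selectors for a fixed P: on a coordinate j ∈ P a selector is a maximal chain
-- of subsets of X_j, on j ∉ P it is an entry of weightedSubsets (m j); both
-- are packed as a pair (chain, set) so that tuples of selectors can be fed to
-- the Sperner condition directly.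
module Selectors (M : ℕ) (m : Fin M → ℕ) (P : Subset M) where

  Selector : Fin M → Set
  Selector j = (Subset (m j) → Bool) × Subset (m j)

  selectors : (j : Fin M) → List (Selector j)
  selectors j = if mem j P
    then map (λ C → C , Subset.⊥) (maximalChains (m j))
    else map (λ D → (λ _ → true) , D) (weightedSubsets (m j))

  selects : (j : Fin M) → Selector j → Subset (m j) → Bool
  selects j s A = if mem j P then proj₁ s A else eqSub A (proj₂ s)

  selectorCount : Fin M → ℕ
  selectorCount j = if mem j P then m j ! else suc (m j) !

  selected : ∀ j (A : Subset (m j)) → sumL (λ s → 𝟙 (selects j s A)) (selectors j) ≡ weight (m j) ∣ A ∣
  selected j A with mem j P
  ... | true = trans (sumL-map _ _ (maximalChains (m j))) (chains-through (m j) A)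
  ... | false = trans (sumL-map _ _ (weightedSubsets (m j))) (copies (m j) A)

  length-selectors : ∀ j → length (selectors j) ≡ selectorCount j
  length-selectors j with mem j P
  ... | true = trans (length-map _ (maximalChains (m j))) (length-maximalChains (m j))
  ... | false = trans (length-map _ (weightedSubsets (m j))) (length-weightedSubsets (m j))

  selectors-chains : ∀ j → All (λ s → mem j P ≡ true → IsChain (proj₁ s)) (selectors j)
  selectors-chains j with mem j P
  ... | true = AllP.map⁺ (All.map (λ {c} ord _ → sizeOrdered⇒chain c ord) (maximalChains-sizeOrdered (m j)))
  ... | false = AllP.map⁺ (All.universal (λ _ ()) (weightedSubsets (m j)))

  selectsX : ((j : Fin M) → Selector j) → SubsetX M m → Bool
  selectsX s = matches P (proj₁ ∘ s) (proj₂ ∘ s)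

  -- LYM-type bound: summing the Sperner condition over all selector tuples
  weighted-bound : ∀ (LP : ℕ) (𝓕 : MultiFamily M m) →
    (∀ Ch → (∀ j → mem j P ≡ true → IsChain (Ch j)) → ∀ D → count (matches P Ch D) 𝓕 ≤ LP) →
    sumL (memberWeight M m) 𝓕 ≤ LP * Π M selectorCount
  weighted-bound LP 𝓕 sperner = begin
    sumL (memberWeight M m) 𝓕
      ≤⟨ double-count selectsX (memberWeight M m) 𝓕 (tuples M selectors) LP selected-tuples bounded ⟩
    LP * length (tuples M selectors)
      ≡⟨ cong (LP *_) (trans (length-tuples M selectors) (Π-cong M length-selectors)) ⟩
    LP * Π M selectorCount ∎
    where
    open ≤-Reasoning
    selected-tuples : ∀ F → sumL (λ s → 𝟙 (selectsX s F)) (tuples M selectors) ≡ memberWeight M m F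
    selected-tuples F = begin-equality
      sumL (λ s → 𝟙 (selectsX s F)) (tuples M selectors)
        ≡⟨ sumL-cong (tuples M selectors) (λ s → 𝟙-allᵇ M (λ j → selects j (s j) (F j))) ⟩
      sumL (λ s → Π M (λ j → 𝟙 (selects j (s j) (F j)))) (tuples M selectors)
        ≡⟨ sumL-tuples M selectors (λ j s → 𝟙 (selects j s (F j))) ⟩
      Π M (λ j → sumL (λ s → 𝟙 (selects j s (F j))) (selectors j))
        ≡⟨ Π-cong M (λ j → selected j (F j)) ⟩
      memberWeight M m F ∎
    bounded : All (λ s → count (selectsX s) 𝓕 ≤ LP) (tuples M selectors)
    bounded = All.map (λ {s} chains → sperner (proj₁ ∘ s) chains (proj₂ ∘ s))
                      (tuples-all M selectors (λ j s → mem j P ≡ true → IsChain (proj₁ s)) selectors-chains)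

delta : ∀ n (u : Fin n) (g : Fin n → ℕ) → sumL (λ i → 𝟙 (toℕ u ≡ᵇ toℕ i) * g i) (allFin n) ≡ g u
delta (suc n) u g = trans (cong (f Fin.zero +_) tail) (head u)
  where
  f : Fin (suc n) → ℕ
  f i = 𝟙 (toℕ u ≡ᵇ toℕ i) * g i
  tail : sumL f (tabulate Fin.suc) ≡ sumL (f ∘ Fin.suc) (allFin n)
  tail = trans (cong (sumL f) (sym (map-tabulate id Fin.suc))) (sumL-map f Fin.suc (allFin n))
  head : ∀ u → 𝟙 (toℕ u ≡ᵇ 0) * g Fin.zero + sumL (λ i → 𝟙 (toℕ u ≡ᵇ toℕ (Fin.suc i)) * g (Fin.suc i)) (allFin n) ≡ g u
  head Fin.zero = trans (cong (g Fin.zero + 0 +_) (sumL-zero (allFin n))) (trans (+-identityʳ _) (+-identityʳ _))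
  head (Fin.suc u) = delta n u (g ∘ Fin.suc)

-- allProfiles (suc M) m prepends every first coordinate to every profile of
-- the remaining coordinates; this names the prepending function used in Defs
allProfiles-suc : ∀ M (m : Fin (suc M) → ℕ) →
  Σ (Fin (suc (m Fin.zero)) → Profile M (m ∘ Fin.suc) → Profile (suc M) m) λ cons →
    allProfiles (suc M) m ≡ concatMap (λ i → map (cons i) (allProfiles M (m ∘ Fin.suc))) (allFin (suc (m Fin.zero)))
allProfiles-suc M m = _ , refl

profile-delta : ∀ M (m : Fin M → ℕ) (u : Profile M m) (h : (j : Fin M) → Fin (suc (m j)) → ℕ) →
  sumL (λ v → Π M (λ j → 𝟙 (toℕ (u j) ≡ᵇ toℕ (v j)) * h j (v j))) (allProfiles M m) ≡ Π M (λ j → h j (u j))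
profile-delta zero m u h = refl
profile-delta (suc M) m u h = begin
  sumL δ (concatMap (λ i → map (cons i) rest) firsts)  ≡⟨ sumL-concatMap δ (λ i → map (cons i) rest) firsts ⟩
  sumL (λ i → sumL δ (map (cons i) rest)) firsts       ≡⟨ sumL-cong firsts first ⟩
  sumL (λ i → a i * Π M (h′ ∘ Fin.suc)) firsts         ≡⟨ sumL-*ʳ _ a firsts ⟨
  sumL a firsts * Π M (h′ ∘ Fin.suc)                   ≡⟨ cong (_* Π M (h′ ∘ Fin.suc)) (delta _ (u Fin.zero) (h Fin.zero)) ⟩
  Π (suc M) h′                                         ∎
  where
  open ≡-Reasoning
  cons = proj₁ (allProfiles-suc M m)
  rest = allProfiles M (m ∘ Fin.suc)
  firsts = allFin (suc (m Fin.zero))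
  δ : Profile (suc M) m → ℕ
  δ v = Π (suc M) (λ j → 𝟙 (toℕ (u j) ≡ᵇ toℕ (v j)) * h j (v j))
  h′ : Fin (suc M) → ℕ
  h′ j = h j (u j)
  a : Fin (suc (m Fin.zero)) → ℕ
  a i = 𝟙 (toℕ (u Fin.zero) ≡ᵇ toℕ i) * h Fin.zero i
  first : ∀ i → sumL δ (map (cons i) rest) ≡ a i * Π M (h′ ∘ Fin.suc)
  first i = begin
    sumL δ (map (cons i) rest)                     ≡⟨ sumL-map δ (cons i) rest ⟩
    sumL (λ v → a i * Π M (λ j → 𝟙 (toℕ (u (Fin.suc j)) ≡ᵇ toℕ (v j)) * h (Fin.suc j) (v j))) rest
                                                   ≡⟨ sumL-*ˡ (a i) _ rest ⟨
    a i * sumL (λ v → Π M (λ j → 𝟙 (toℕ (u (Fin.suc j)) ≡ᵇ toℕ (v j)) * h (Fin.suc j) (v j))) rest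
                                                   ≡⟨ cong (a i *_) (profile-delta M (m ∘ Fin.suc) (u ∘ Fin.suc) (h ∘ Fin.suc)) ⟩
    a i * Π M (h′ ∘ Fin.suc)                       ∎

profileWeight : ∀ M (m : Fin M → ℕ) → Profile M m → ℕ
profileWeight M m v = Π M (λ j → weight (m j) (toℕ (v j)))

group-by-profile : ∀ M (m : Fin M → ℕ) (𝓕 : MultiFamily M m) →
  sumL (λ v → profileMatrix 𝓕 v * profileWeight M m v) (allProfiles M m) ≡ sumL (memberWeight M m) 𝓕
group-by-profile M m 𝓕 = begin
  sumL (λ v → profileMatrix 𝓕 v * profileWeight M m v) profiles
    ≡⟨ sumL-cong profiles (λ v → trans (cong (_* profileWeight M m v) (count≡sumL _ 𝓕)) (sumL-*ʳ (profileWeight M m v) _ 𝓕)) ⟩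
  sumL (λ v → sumL (λ F → 𝟙 (eqProfile (profile F) v) * profileWeight M m v) 𝓕) profiles
    ≡⟨ sumL-swap (λ v F → 𝟙 (eqProfile (profile F) v) * profileWeight M m v) profiles 𝓕 ⟩
  sumL (λ F → sumL (λ v → 𝟙 (eqProfile (profile F) v) * profileWeight M m v) profiles) 𝓕
    ≡⟨ sumL-cong 𝓕 (λ F → trans (sumL-cong profiles (delta-as-product (profile F)))
                                (profile-delta M m (profile F) (λ j i → weight (m j) (toℕ i)))) ⟩
  sumL (λ F → profileWeight M m (profile F)) 𝓕
    ≡⟨ sumL-cong 𝓕 (λ F → Π-cong M (λ j → cong (weight (m j)) (toℕ-fromℕ< (s≤s (∣p∣≤n (F j)))))) ⟩
  sumL (memberWeight M m) 𝓕 ∎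
  where
  open ≡-Reasoning
  profiles = allProfiles M m
  delta-as-product : ∀ u v → 𝟙 (eqProfile u v) * profileWeight M m v ≡
                             Π M (λ j → 𝟙 (toℕ (u j) ≡ᵇ toℕ (v j)) * weight (m j) (toℕ (v j)))
  delta-as-product u v = trans (cong (_* profileWeight M m v) (𝟙-allᵇ M (λ j → toℕ (u j) ≡ᵇ toℕ (v j))))
                               (sym (Π-* M _ _))

-- Fractions of naturals as unnormalised rationals; comparisons reduce to
-- cross-multiplication in ℕ.
frac : ℕ → (d : ℕ) → .{{NonZero d}} → ℚᵘ
frac a d = ℤ.+ a ℚᵘ./ d

÷-frac : ∀ a d .{{_ : NonZero d}} → toℚᵘ (a ÷ d) ≃ᵘ frac a d
÷-frac a (suc d) = toℚᵘ-fromℚᵘ (mkℚᵘ (ℤ.+ a) d)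

frac-cong : ∀ {a c} d e .{{_ : NonZero d}} .{{_ : NonZero e}} → a * e ≡ c * d → frac a d ≃ᵘ frac c e
frac-cong {a} {c} (suc d) (suc e) ae≡cd =
  *≡* (trans (sym (pos-* a (suc e))) (trans (cong ℤ.+_ ae≡cd) (pos-* c (suc d))))

frac-mono : ∀ {a c} d e .{{_ : NonZero d}} .{{_ : NonZero e}} → a * e ≤ c * d → frac a d ≤ᵘ frac c e
frac-mono {a} {c} (suc d) (suc e) ae≤cd =
  *≤* (subst₂ ℤ._≤_ (pos-* a (suc e)) (pos-* c (suc d)) (ℤ.+≤+ ae≤cd))

frac-+ : ∀ a c d .{{_ : NonZero d}} → frac a d ℚᵘ.+ frac c d ≃ᵘ frac (a + c) d
frac-+ a c d@(suc _) = *≡* (begin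
  (ℤ.+ a ℤ.* ℤ.+ d ℤ.+ ℤ.+ c ℤ.* ℤ.+ d) ℤ.* ℤ.+ d
    ≡⟨ cong (ℤ._* ℤ.+ d) (cong₂ ℤ._+_ (pos-* a d) (pos-* c d)) ⟨
  (ℤ.+ (a * d) ℤ.+ ℤ.+ (c * d)) ℤ.* ℤ.+ d
    ≡⟨ cong (ℤ._* ℤ.+ d) (pos-+ (a * d) (c * d)) ⟨
  ℤ.+ (a * d + c * d) ℤ.* ℤ.+ d
    ≡⟨ pos-* (a * d + c * d) d ⟨
  ℤ.+ ((a * d + c * d) * d)
    ≡⟨ cong ℤ.+_ (trans (cong (_* d) (sym (*-distribʳ-+ d a c))) (*-assoc (a + c) d d)) ⟩
  ℤ.+ ((a + c) * (d * d))
    ≡⟨ pos-* (a + c) (d * d) ⟩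
  ℤ.+ (a + c) ℤ.* ℤ.+ (d * d) ∎)
  where open ≡-Reasoning

frac-*-whole : ∀ a c d .{{_ : NonZero d}} → frac a d ℚᵘ.* frac c 1 ≃ᵘ frac (a * c) d
frac-*-whole a c (suc n) = *≡* (cong₂ ℤ._*_ (sym (pos-* a c)) (cong ℤ.+_ (sym (*-identityʳ (suc n)))))

sumℚ-frac : ∀ {X : Set} (f : X → ℚ) (g : X → ℕ) d .{{_ : NonZero d}} → (∀ x → toℚᵘ (f x) ≃ᵘ frac (g x) d) →
  ∀ xs → toℚᵘ (sumℚ (map f xs)) ≃ᵘ frac (sumL g xs) d
sumℚ-frac f g (suc n) each [] = *≡* refl
sumℚ-frac f g d@(suc _) each (x ∷ xs) =
  ≃ᵘ-trans (toℚᵘ-homo-+ (f x) (sumℚ (map f xs)))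
  (≃ᵘ-trans (+ᵘ-cong (each x) (sumℚ-frac f g d each xs)) (frac-+ (g x) (sumL g xs) d))

-- ∏_j m_j!, the common denominator of the left-hand side
factorials : ∀ M → (Fin M → ℕ) → ℕ
factorials M m = Π M (λ j → m j !)

factorials-nonZero : ∀ M (m : Fin M → ℕ) → NonZero (factorials M m)
factorials-nonZero M m = Π-nonZero M (λ j → m j !) (λ j → m j !≢0)

÷-rescale : ∀ p b w N .{{_ : NonZero N}} → b * w ≡ N → toℚᵘ (p ÷ b) ≃ᵘ frac (p * w) N
÷-rescale p zero w N 0≡N = ⊥-elim (≢-nonZero⁻¹ N (sym 0≡N))
÷-rescale p b@(suc _) w N bw≡N = ≃ᵘ-trans (÷-frac p b) (frac-cong b N (begin
  p * N        ≡⟨ cong (p *_) bw≡N ⟨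
  p * (b * w)  ≡⟨ cong (p *_) (*-comm b w) ⟩
  p * (w * b)  ≡⟨ *-assoc p w b ⟨
  p * w * b    ∎))
  where open ≡-Reasoning

-- lhs = (Σ_F weight F) / ∏_j m_j!, since binom(m_j, i_j) · weight = m_j!
lhs-as-frac : ∀ M (m : Fin M → ℕ) (𝓕 : MultiFamily M m) →
  toℚᵘ (lhs M m 𝓕) ≃ᵘ frac (sumL (memberWeight M m) 𝓕) (factorials M m) {{factorials-nonZero M m}}
lhs-as-frac M m 𝓕 = subst (λ s → toℚᵘ (lhs M m 𝓕) ≃ᵘ frac s (factorials M m)) (group-by-profile M m 𝓕)
  (sumℚ-frac _ (λ v → profileMatrix 𝓕 v * profileWeight M m v) (factorials M m) term (allProfiles M m))
  where
  instance _ = factorials-nonZero M m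
  binomials : Profile M m → ℕ
  binomials v = prodFin M (λ j → m j C toℕ (v j))
  binomials-profileWeight : ∀ v → binomials v * profileWeight M m v ≡ factorials M m
  binomials-profileWeight v = begin
    binomials v * profileWeight M m v
      ≡⟨ cong (_* profileWeight M m v) (prodFin≡Π M _) ⟩
    Π M (λ j → m j C toℕ (v j)) * profileWeight M m v
      ≡⟨ Π-* M (λ j → m j C toℕ (v j)) (λ j → weight (m j) (toℕ (v j))) ⟨
    Π M (λ j → (m j C toℕ (v j)) * weight (m j) (toℕ (v j)))
      ≡⟨ Π-cong M (λ j → binomial-weight (m j) (toℕ (v j)) (≤-pred (toℕ<n (v j)))) ⟩
    factorials M m ∎
    where open ≡-Reasoning
  term : ∀ v → toℚᵘ (profileMatrix 𝓕 v ÷ binomials v) ≃ᵘ frac (profileMatrix 𝓕 v * profileWeight M m v) (factorials M m)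
  term v = ÷-rescale (profileMatrix 𝓕 v) (binomials v) (profileWeight M m v) (factorials M m) (binomials-profileWeight v)

sizeInP : ∀ {M} → (Fin M → ℕ) → Subset M → Fin M → ℕ
sizeInP m P j = if mem j P then suc (m j) else 1

sizeInP-nonZero : ∀ M (m : Fin M → ℕ) P → NonZero (prodFin M (sizeInP m P))
sizeInP-nonZero M m P = subst NonZero (sym (prodFin≡Π M (sizeInP m P))) (Π-nonZero M (sizeInP m P) nonZero)
  where
  nonZero : ∀ j → NonZero (sizeInP m P j)
  nonZero j with mem j P
  ... | true = _
  ... | false = _

rhs-as-frac : ∀ M (m : Fin M → ℕ) (L : Subset M → ℕ) P →
  toℚᵘ (rhs M m L P) ≃ᵘ frac (L P * prodFin M (suc ∘ m)) (prodFin M (sizeInP m P)) {{sizeInP-nonZero M m P}}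
rhs-as-frac M m L P =
  ≃ᵘ-trans (toℚᵘ-homo-* (L P ÷ prodFin M (sizeInP m P)) (ℕtoℚ (prodFin M (suc ∘ m))))
  (≃ᵘ-trans (*ᵘ-cong (÷-frac (L P) (prodFin M (sizeInP m P))) (÷-frac (prodFin M (suc ∘ m)) 1))
            (frac-*-whole (L P) (prodFin M (suc ∘ m)) (prodFin M (sizeInP m P))))
  where instance _ = sizeInP-nonZero M m P

selectorCount-balance : ∀ M (m : Fin M → ℕ) P →
  Π M (Selectors.selectorCount M m P) * prodFin M (sizeInP m P) ≡ factorials M m * prodFin M (suc ∘ m)
selectorCount-balance M m P = begin
  Π M sel * prodFin M (sizeInP m P)     ≡⟨ cong (Π M sel *_) (prodFin≡Π M (sizeInP m P)) ⟩
  Π M sel * Π M (sizeInP m P)           ≡⟨ Π-* M sel (sizeInP m P) ⟨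
  Π M (λ j → sel j * sizeInP m P j)     ≡⟨ Π-cong M balance ⟩
  Π M (λ j → m j ! * suc (m j))         ≡⟨ Π-* M (λ j → m j !) (suc ∘ m) ⟩
  factorials M m * Π M (suc ∘ m)        ≡⟨ cong (factorials M m *_) (prodFin≡Π M (suc ∘ m)) ⟨
  factorials M m * prodFin M (suc ∘ m)  ∎
  where
  open ≡-Reasoning
  sel = Selectors.selectorCount M m P
  balance : ∀ j → sel j * sizeInP m P j ≡ m j ! * suc (m j)
  balance j with mem j P
  ... | true = refl
  ... | false = trans (*-identityʳ (suc (m j) !)) (*-comm (suc (m j)) (m j !))

cross-multiplied-bound : ∀ M (m : Fin M → ℕ) (LP : ℕ) P (𝓕 : MultiFamily M m) →
  (∀ Ch → (∀ j → mem j P ≡ true → IsChain (Ch j)) → ∀ D → count (matches P Ch D) 𝓕 ≤ LP) →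
  sumL (memberWeight M m) 𝓕 * prodFin M (sizeInP m P) ≤ LP * prodFin M (suc ∘ m) * factorials M m
cross-multiplied-bound M m LP P 𝓕 sperner = begin
  S * R                ≤⟨ *-monoˡ-≤ R (Selectors.weighted-bound M m P LP 𝓕 sperner) ⟩
  LP * counted * R     ≡⟨ *-assoc LP counted R ⟩
  LP * (counted * R)   ≡⟨ cong (LP *_) (selectorCount-balance M m P) ⟩
  LP * (N * T)         ≡⟨ cong (LP *_) (*-comm N T) ⟩
  LP * (T * N)         ≡⟨ *-assoc LP T N ⟨
  LP * T * N           ∎
  where
  open ≤-Reasoning
  S = sumL (memberWeight M m) 𝓕
  N = factorials M m
  T = prodFin M (suc ∘ m)
  R = prodFin M (sizeInP m P)
  counted = Π M (Selectors.selectorCount M m P)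

theorem4p1 : (M : ℕ) (m : Fin M → ℕ) (k : ℕ) → 1 ≤ k → k ≤ M →
    (L : Subset M → ℕ) → (∀ P → ∣ P ∣ ≡ k → 1 ≤ L P) →
    (𝓕 : MultiFamily M m) → IsSperner M m k L 𝓕 →
    ∀ (P : Subset M) → ∣ P ∣ ≡ k →
    lhs M m 𝓕 ≤ℚ rhs M m L P
theorem4p1 M m k _ _ L _ 𝓕 sperner P ∣P∣≡k = toℚᵘ-cancel-≤ (begin
  toℚᵘ (lhs M m 𝓕)                   ≃⟨ lhs-as-frac M m 𝓕 ⟩
  frac (sumL (memberWeight M m) 𝓕) N  ≤⟨ frac-mono N R (cross-multiplied-bound M m (L P) P 𝓕 (sperner P ∣P∣≡k)) ⟩
  frac (L P * prodFin M (suc ∘ m)) R  ≃⟨ rhs-as-frac M m L P ⟨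
  toℚᵘ (rhs M m L P)                  ∎)
  where
  open ℚᵘ-≤-Reasoning
  N = factorials M m
  R = prodFin M (sizeInP m P)
  instance _ = factorials-nonZero M m
  instance _ = sizeInP-nonZero M m P
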